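{- Let $n\ge 3$. If the hypercube $Q_n$ has a $k$-symmetric Hamilton cycle, then $k=2^i<2n$ for some integer $i\ge 0$.
   Context: $Q_n$ has as vertices all bitstrings of length $n$, adjacent iff they differ in exactly one bit. For a graph $G$ with $N$ vertices, a Hamilton cycle $C=(x_1,\ldots,x_N)$ is $k$-symmetric (for a positive integer $k$ dividing $N$) if the map $x_i\mapsto x_{i+N/k}$ (indices modulo $N$) is an automorphism of $G$. -}

module Defs where

open import Data.Nat using (ℕ; zero; suc; _+_; _*_; _^_; _<_; NonZero)
open import Data.Nat.DivMod using (_/_; _%_; m%n<n)
open import Data.Nat.Divisibility using (_∣_)
open import Data.Bool using (Bool)
open import Data.Vec using (Vec; lookup)
open import Data.Fin using (Fin; toℕ; fromℕ<)
open import Data.Product using (Σ; _×_; ∃)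
open import Relation.Binary.PropositionalEquality using (_≡_)
open import Relation.Nullary using (¬_)
open import Data.Nat.Properties using (m^n≢0)
open import Function.Definitions using (Injective; Surjective)

Vertex : ℕ → Set
Vertex n = Vec Bool n

Adjacent : ∀ {n} → Vertex n → Vertex n → Set
Adjacent {n} u v =
  Σ (Fin n) λ i → (¬ lookup u i ≡ lookup v i) ×
                   (∀ j → ¬ j ≡ i → lookup u j ≡ lookup v j)

N : ℕ → ℕ
N n = 2 ^ n

N-nonZero : ∀ n → NonZero (N n)
N-nonZero n = m^n≢0 2 n

shift : ∀ n → ℕ → Fin (N n) → Fin (N n)
shift n s i = fromℕ< (m%n<n (toℕ i + s) (N n) {{N-nonZero n}})

IsAutomorphism : ∀ n → (Vertex n → Vertex n) → Set
IsAutomorphism n f =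
  Injective _≡_ _≡_ f × Surjective _≡_ _≡_ f ×
  (∀ u v → (Adjacent u v → Adjacent (f u) (f v)) × (Adjacent (f u) (f v) → Adjacent u v))

IsHamiltonCycle : ∀ n → (Fin (N n) → Vertex n) → Set
IsHamiltonCycle n x =
  Injective _≡_ _≡_ x × Surjective _≡_ _≡_ x ×
  (∀ i → Adjacent (x i) (x (shift n 1 i)))

IsKSymmetric : ∀ n → ℕ → (Fin (N n) → Vertex n) → Set
IsKSymmetric n k x =
  Σ (NonZero k) λ nz → (k ∣ N n) ×
    ∃ λ (f : Vertex n → Vertex n) → IsAutomorphism n f ×
      (∀ i → f (x i) ≡ x (shift n (_/_ (N n) k {{nz}}) i))

{-# OPTIONS --safe #-}
module Submission where

-- An injective adjacency-preserving map f of Q_n permutes the directions: f (flipAt v i) = flipAt (f v) (σ i)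
-- for an injection σ, so (f v)_{σ c} = v_c ⊕ a_{σ c} with a = f 0.  If f shifts a Hamilton cycle by s = 2^n/k
-- steps, then f^j moves every cycle vertex for 0 < j < k, f^k = id, hence σ^k = id, and k ∣ 2^n is a power of 2.
-- Suppose k = 4q ≥ 2n.  If σ^q = id, then f^q is a translation and f^{2q} = id, a contradiction.  Otherwise
-- some direction has σ-period a power of two not dividing q, so it is ≥ 2q ≥ n: σ is a single n-cycle and
-- k = 2n.  As n ≥ 3, k < 2^n and s is even, so f preserves the parity of vertices along the cycle, i.e. a has
-- even weight.  But f^n is the translation whose every bit is the sum of a over the full σ-orbit, the weight
-- of a; so f^n = id with n < k, again a contradiction.

open import Algebra.Bundles using (CommutativeRing)
open import Data.Bool using (Bool; true; false; not; _xor_)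
open import Data.Bool.Properties
  using (not-involutive; not-distribˡ-xor; not-distribʳ-xor; ¬-not; xor-assoc; xor-same; xor-identityʳ; xor-∧-commutativeRing)
open import Data.Empty using (⊥)
open import Data.Fin using (Fin; zero; suc; toℕ; fromℕ<; punchOut)
open import Data.Fin.Permutation using (permutation)
open import Data.Fin.Properties
  using (all?; any?; ¬∀⟶∃¬; toℕ<n; toℕ-injective; toℕ-fromℕ<; injective⇒≤; punchOut-injective)
  renaming (_≟_ to _≟ᶠ_)
open import Data.Nat
  using (ℕ; zero; suc; _+_; _*_; _^_; _∸_; _≤_; _<_; _≤?_; z≤n; s≤s; NonZero; >-nonZero; >-nonZero⁻¹; ≢-nonZero⁻¹)
open import Data.Nat.Coprimality using (Coprime; coprime-divisor)
open import Data.Nat.Divisibility using (_∣_; divides; _∣?_; ∣1⇒≡1; *-cancelʳ-∣; m%n≡0⇒n∣m)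
open import Data.Nat.DivMod
  using (_%_; _/_; m%n<n; m≡m%n+[m/n]*n; m/n*n≡m; %-distribˡ-+; m%n%n≡m%n; [m+n]%n≡m%n; m<n⇒m%n≡m)
open import Data.Nat.GeneralisedArithmetic using (iterate)
open import Data.Nat.Primality using (irreducible[2])
open import Data.Nat.Properties
open import Data.Product using (Σ; ∃-syntax; _×_; _,_; proj₁; proj₂; uncurry)
open import Data.Sum using (_⊎_; inj₁; inj₂)
open import Data.Vec using (_∷_; []; lookup; replicate; updateAt)
open import Data.Vec.Properties
  using (lookup∘updateAt; lookup∘updateAt′; updateAt-updateAt; updateAt-id-local; updateAt-commutes;
         tabulate∘lookup; tabulate-cong; lookup-replicate)
open import Function.Definitions using (Injective; Surjective)
open import Relation.Binary.Definitions using (DecidableEquality)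
open import Relation.Binary.PropositionalEquality
open import Relation.Nullary using (¬_; yes; no; contradiction)

open import Algebra.Properties.CommutativeMonoid.Sum (CommutativeRing.+-commutativeMonoid xor-∧-commutativeRing)
  using (sum; sum-syntax; sum-permute)

open import Defs

∣2^⇒≡2^ : ∀ m {d} → d ∣ 2 ^ m → ∃[ i ] d ≡ 2 ^ i
∣2^⇒≡2^ zero d∣1 = 0 , ∣1⇒≡1 d∣1
∣2^⇒≡2^ (suc m) {d} d∣2^1+m with 2 ∣? d
... | yes (divides e refl) with ∣2^⇒≡2^ m {e} (*-cancelʳ-∣ 2 (subst (e * 2 ∣_) (*-comm 2 (2 ^ m)) d∣2^1+m))
...   | i , refl = suc i , *-comm (2 ^ i) 2
∣2^⇒≡2^ (suc m) {d} d∣2^1+m | no 2∤d = ∣2^⇒≡2^ m (coprime-divisor d⊥2 d∣2^1+m)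
  where
  d⊥2 : Coprime d 2
  d⊥2 (e∣d , e∣2) with irreducible[2] e∣2
  ... | inj₁ e≡1 = e≡1
  ... | inj₂ refl = contradiction e∣d 2∤d

2*n<2^n : ∀ {n} → 3 ≤ n → 2 * n < 2 ^ n
2*n<2^n {suc (suc (suc m))} (s≤s (s≤s (s≤s _))) = go m
  where
  go : ∀ m → 2 * (3 + m) < 2 ^ (3 + m)
  go zero = m<n⇒m<1+n (n<1+n 6)
  go (suc m) = begin-strict
    2 * suc k     ≡⟨ *-suc 2 k ⟩
    2 + 2 * k     <⟨ +-monoʳ-< 2 (go m) ⟩
    2 + 2 ^ k     ≤⟨ +-monoˡ-≤ (2 ^ k) (^-monoʳ-≤ 2 {1} {k} (s≤s z≤n)) ⟩
    2 ^ k + 2 ^ k ≡⟨ cong (2 ^ k +_) (sym (+-identityʳ (2 ^ k))) ⟩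
    2 ^ suc k     ∎
    where
    open ≤-Reasoning
    k : ℕ
    k = 3 + m

2^u∣2^i⊎2^[1+i]≤2^u : ∀ u i → 2 ^ u ∣ 2 ^ i ⊎ 2 ^ suc i ≤ 2 ^ u
2^u∣2^i⊎2^[1+i]≤2^u u i with u ≤? i
... | yes u≤i = inj₁ (divides (2 ^ (i ∸ u)) (begin
  2 ^ i               ≡⟨ cong (2 ^_) (sym (m+[n∸m]≡n u≤i)) ⟩
  2 ^ (u + (i ∸ u))   ≡⟨ ^-distribˡ-+-* 2 u (i ∸ u) ⟩
  2 ^ u * 2 ^ (i ∸ u) ≡⟨ *-comm (2 ^ u) _ ⟩
  2 ^ (i ∸ u) * 2 ^ u ∎))
  where open ≡-Reasoning
... | no u≰i = inj₂ (^-monoʳ-≤ 2 (≰⇒> u≰i))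

[m%n+o]%n≡[m+o]%n : ∀ m o n .{{_ : NonZero n}} → (m % n + o) % n ≡ (m + o) % n
[m%n+o]%n≡[m+o]%n m o n = begin
  (m % n + o) % n           ≡⟨ %-distribˡ-+ (m % n) o n ⟩
  (m % n % n + o % n) % n   ≡⟨ cong (λ r → (r + o % n) % n) (m%n%n≡m%n m n) ⟩
  (m % n + o % n) % n       ≡⟨ sym (%-distribˡ-+ m o n) ⟩
  (m + o) % n               ∎
  where open ≡-Reasoning

m<2*m : ∀ {m} → 0 < m → m < 2 * m
m<2*m {m} 0<m = m<m+n m (subst (0 <_) (sym (+-identityʳ m)) 0<m)

module _ {A : Set} (f : A → A) where

  iterate-+ : ∀ x m n → iterate f x (m + n) ≡ iterate f (iterate f x m) n
  iterate-+ x zero    n = refl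
  iterate-+ x (suc m) n = iterate-+ (f x) m n

  iterate-comm : ∀ x m n → iterate f (iterate f x m) n ≡ iterate f (iterate f x n) m
  iterate-comm x m n = trans (sym (iterate-+ x m n)) (trans (cong (iterate f x) (+-comm m n)) (iterate-+ x n m))

  iterate-injective : Injective _≡_ _≡_ f → ∀ j → Injective _≡_ _≡_ (λ x → iterate f x j)
  iterate-injective f-inj zero    eq = eq
  iterate-injective f-inj (suc j) eq = f-inj (iterate-injective f-inj j eq)

  iterate-*-fixed : ∀ {x p} → iterate f x p ≡ x → ∀ t → iterate f x (t * p) ≡ x
  iterate-*-fixed fx zero = refl
  iterate-*-fixed {x} {p} fx (suc t) = begin
    iterate f x (p + t * p)           ≡⟨ iterate-+ x p (t * p) ⟩
    iterate f (iterate f x p) (t * p) ≡⟨ cong (λ y → iterate f y (t * p)) fx ⟩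
    iterate f x (t * p)               ≡⟨ iterate-*-fixed fx t ⟩
    x                                 ∎
    where open ≡-Reasoning

record LeastPeriod {A : Set} (f : A → A) (x : A) (p : ℕ) : Set where
  constructor leastPeriod
  field
    positive : 0 < p
    returns  : iterate f x p ≡ x
    minimal  : ∀ {j} → 0 < j → j < p → iterate f x j ≢ x

module _ {A : Set} {f : A → A} where

  leastPeriod-exists : DecidableEquality A →
                       ∀ {x k} → 0 < k → iterate f x k ≡ x → ∃[ p ] LeastPeriod f x p
  leastPeriod-exists _≟_ {x} {suc k} _ fᵏx≡x = below (suc k) (k , ≤-refl , fᵏx≡x)
    where
    below : ∀ b → ∃[ j ] j < b × iterate f x (suc j) ≡ x → ∃[ p ] LeastPeriod f x p
    below (suc b) (j , j<1+b , fʲx≡x) with anyUpTo? (λ j → iterate f x (suc j) ≟ x) b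
    ... | yes earlier = below b earlier
    ... | no none with m<1+n⇒m<n∨m≡n j<1+b
    ...   | inj₁ j<b  = contradiction (j , j<b , fʲx≡x) none
    ...   | inj₂ refl = suc j , leastPeriod (s≤s z≤n) fʲx≡x minimal
      where
      minimal : ∀ {i} → 0 < i → i < suc j → iterate f x i ≢ x
      minimal {suc i} _ (s≤s i<j) fⁱx≡x = none (i , i<j , fⁱx≡x)

  module _ {x : A} {p : ℕ} (period : LeastPeriod f x p) where

    open LeastPeriod period

    private instance
      p≢0 : NonZero p
      p≢0 = >-nonZero positive

    private
      no-shorter : ∀ {r} → r < p → iterate f x r ≡ x → r ≡ 0
      no-shorter {zero}  _   _     = refl
      no-shorter {suc r} r<p fʳx≡x = contradiction fʳx≡x (minimal (s≤s z≤n) r<p)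

    leastPeriod-∣ : ∀ {j} → iterate f x j ≡ x → p ∣ j
    leastPeriod-∣ {j} fʲx≡x = m%n≡0⇒n∣m j p (no-shorter (m%n<n j p) (begin
      iterate f x r                               ≡⟨ cong (λ y → iterate f y r) (sym (iterate-*-fixed f returns (j / p))) ⟩
      iterate f (iterate f x (j / p * p)) r       ≡⟨ sym (iterate-+ f x (j / p * p) r) ⟩
      iterate f x (j / p * p + r)                 ≡⟨ cong (iterate f x) (trans (+-comm (j / p * p) r) (sym (m≡m%n+[m/n]*n j p))) ⟩
      iterate f x j                               ≡⟨ fʲx≡x ⟩
      x                                           ∎))
      where
      open ≡-Reasoning
      r : ℕ
      r = j % p

    module _ (f-injective : Injective _≡_ _≡_ f) where

      private
        return-≤ : ∀ {i j} → i ≤ j → j < p → iterate f x i ≡ iterate f x j → j ≤ i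
        return-≤ {i} {j} i≤j j<p fⁱx≡fʲx = m∸n≡0⇒m≤n (no-shorter (≤-<-trans (m∸n≤m j i) j<p)
          (iterate-injective f f-injective i (begin
            iterate f (iterate f x (j ∸ i)) i ≡⟨ iterate-comm f x (j ∸ i) i ⟩
            iterate f (iterate f x i) (j ∸ i) ≡⟨ sym (iterate-+ f x i (j ∸ i)) ⟩
            iterate f x (i + (j ∸ i))         ≡⟨ cong (iterate f x) (m+[n∸m]≡n i≤j) ⟩
            iterate f x j                     ≡⟨ sym fⁱx≡fʲx ⟩
            iterate f x i                     ∎)))
          where open ≡-Reasoning

      orbit-injective : ∀ {i j} → i < p → j < p → iterate f x i ≡ iterate f x j → i ≡ j
      orbit-injective {i} {j} i<p j<p eq with ≤-total i j
      ... | inj₁ i≤j = ≤-antisym i≤j (return-≤ i≤j j<p eq)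
      ... | inj₂ j≤i = ≤-antisym (return-≤ j≤i i<p (sym eq)) j≤i

injective⇒surjective : ∀ {m} {g : Fin m → Fin m} → Injective _≡_ _≡_ g → ∀ y → ∃[ i ] g i ≡ y
injective⇒surjective {suc m} {g} g-injective y with any? (λ i → g i ≟ᶠ y)
... | yes hit = hit
... | no miss = contradiction (injective⇒≤ punchOut∘g-injective) 1+n≰n
  where
  y≢g : ∀ i → y ≢ g i
  y≢g i eq = miss (i , sym eq)

  punchOut∘g-injective : Injective _≡_ _≡_ (λ i → punchOut (y≢g i))
  punchOut∘g-injective eq = g-injective (punchOut-injective (y≢g _) (y≢g _) eq)

sum-reindex : ∀ {m} (b : Fin m → Bool) {g : Fin m → Fin m} → Injective _≡_ _≡_ g →
              ∑[ i < m ] b (g i) ≡ sum b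
sum-reindex b {g} g-injective = sym (sum-permute b (permutation g g⁻¹ g∘g⁻¹ g⁻¹∘g))
  where
  g⁻¹ : _ → _
  g⁻¹ y = proj₁ (injective⇒surjective g-injective y)

  g∘g⁻¹ : ∀ y → g (g⁻¹ y) ≡ y
  g∘g⁻¹ y = proj₂ (injective⇒surjective g-injective y)

  g⁻¹∘g : ∀ i → g⁻¹ (g i) ≡ i
  g⁻¹∘g i = g-injective (g∘g⁻¹ (g i))

module _ {n : ℕ} {σ : Fin n → Fin n} (σ-injective : Injective _≡_ _≡_ σ) {d : Fin n} where

  private
    finOrbit-injective : ∀ {p} → LeastPeriod σ d p →
                         Injective _≡_ _≡_ (λ (i : Fin p) → iterate σ d (toℕ i))
    finOrbit-injective period eq = toℕ-injective (orbit-injective period σ-injective (toℕ<n _) (toℕ<n _) eq)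

  leastPeriod-≤ : ∀ {p} → LeastPeriod σ d p → p ≤ n
  leastPeriod-≤ period = injective⇒≤ (finOrbit-injective period)

  full-cycle : LeastPeriod σ d n →
               ∀ c → iterate σ c n ≡ c × Injective _≡_ _≡_ (λ (i : Fin n) → iterate σ c (toℕ i))
  full-cycle period c with injective⇒surjective (finOrbit-injective period) c
  ... | m , refl = σⁿc≡c , orbitᶜ-injective
    where
    σⁿc≡c : iterate σ (iterate σ d (toℕ m)) n ≡ iterate σ d (toℕ m)
    σⁿc≡c = trans (iterate-comm σ d (toℕ m) n) (cong (λ y → iterate σ y (toℕ m)) (LeastPeriod.returns period))

    orbitᶜ-injective : Injective _≡_ _≡_ (λ (i : Fin n) → iterate σ (iterate σ d (toℕ m)) (toℕ i))
    orbitᶜ-injective {a} {b} eq = finOrbit-injective period (iterate-injective σ σ-injective (toℕ m)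
      (trans (sym (iterate-comm σ d (toℕ m) (toℕ a))) (trans eq (iterate-comm σ d (toℕ m) (toℕ b)))))

not-≢ : ∀ b → not b ≢ b
not-≢ true  ()
not-≢ false ()

flipAt : ∀ {n} → Vertex n → Fin n → Vertex n
flipAt v i = updateAt v i not

zeros : ∀ {n} → Vertex n
zeros = replicate _ false

module _ {n : ℕ} where

  lookup-flipAt : ∀ (v : Vertex n) i → lookup (flipAt v i) i ≡ not (lookup v i)
  lookup-flipAt v i = lookup∘updateAt i v

  lookup-flipAt-≢ : ∀ (v : Vertex n) {i j} → j ≢ i → lookup (flipAt v i) j ≡ lookup v j
  lookup-flipAt-≢ v j≢i = lookup∘updateAt′ _ _ j≢i v

  flipAt-involutive : ∀ (v : Vertex n) i → flipAt (flipAt v i) i ≡ v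
  flipAt-involutive v i = trans (updateAt-updateAt i v) (updateAt-id-local i v (not-involutive _))

  flipAt-comm : ∀ (v : Vertex n) i j → flipAt (flipAt v i) j ≡ flipAt (flipAt v j) i
  flipAt-comm v i j with i ≟ᶠ j
  ... | yes refl = refl
  ... | no i≢j   = updateAt-commutes j i (λ j≡i → i≢j (sym j≡i)) v

  lookup-injective : ∀ {u v : Vertex n} → (∀ i → lookup u i ≡ lookup v i) → u ≡ v
  lookup-injective {u} {v} eq = trans (sym (tabulate∘lookup u)) (trans (tabulate-cong eq) (tabulate∘lookup v))

  flipAt-injectiveʳ : ∀ (v : Vertex n) {i j} → flipAt v i ≡ flipAt v j → i ≡ j
  flipAt-injectiveʳ v {i} {j} eq with i ≟ᶠ j
  ... | yes i≡j = i≡j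
  ... | no i≢j  = contradiction (begin
    not (lookup v i)         ≡⟨ sym (lookup-flipAt v i) ⟩
    lookup (flipAt v i) i    ≡⟨ cong (λ w → lookup w i) eq ⟩
    lookup (flipAt v j) i    ≡⟨ lookup-flipAt-≢ v i≢j ⟩
    lookup v i               ∎) (not-≢ _)
    where open ≡-Reasoning

flipAt-induction : ∀ {n} (P : Vertex n → Set) → P zeros → (∀ v i → P v → P (flipAt v i)) → ∀ v → P v
flipAt-induction P P0 step [] = P0
flipAt-induction P P0 step (b ∷ v) =
  extend b (flipAt-induction (λ w → P (false ∷ w)) P0 (λ w i → step (false ∷ w) (suc i)) v)
  where
  extend : ∀ b → P (false ∷ v) → P (b ∷ v)
  extend false P[false∷v] = P[false∷v]
  extend true  P[false∷v] = step (false ∷ v) zero P[false∷v]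

module _ {n : ℕ} where

  Adjacent⇒flipAt : ∀ (u v : Vertex n) → Adjacent u v → ∃[ i ] v ≡ flipAt u i
  Adjacent⇒flipAt u v (i , uᵢ≢vᵢ , agree) = i , lookup-injective pointwise
    where
    pointwise : ∀ j → lookup v j ≡ lookup (flipAt u i) j
    pointwise j with j ≟ᶠ i
    ... | yes refl = trans (¬-not (λ eq → uᵢ≢vᵢ (sym eq))) (sym (lookup-flipAt u i))
    ... | no j≢i   = trans (sym (agree j j≢i)) (sym (lookup-flipAt-≢ u j≢i))

  flipAt-Adjacent : ∀ (v : Vertex n) i → Adjacent v (flipAt v i)
  flipAt-Adjacent v i =
    i , (λ eq → not-≢ _ (sym (trans eq (lookup-flipAt v i)))) , λ j j≢i → sym (lookup-flipAt-≢ v j≢i)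

  flipAt-square : ∀ (v : Vertex n) {α β γ δ} → flipAt (flipAt v α) β ≡ flipAt (flipAt v δ) γ →
                  α ≢ δ → β ≡ δ ⊎ β ≡ α
  flipAt-square v {α} {β} {γ} {δ} eq α≢δ with β ≟ᶠ δ | β ≟ᶠ α
  ... | yes β≡δ | _       = inj₁ β≡δ
  ... | no _    | yes β≡α = inj₂ β≡α
  ... | no β≢δ  | no β≢α with γ ≟ᶠ δ
  ...   | no γ≢δ = contradiction (begin
    lookup v δ                          ≡⟨ sym (lookup-flipAt-≢ v (≢-sym α≢δ)) ⟩
    lookup (flipAt v α) δ               ≡⟨ sym (lookup-flipAt-≢ (flipAt v α) (≢-sym β≢δ)) ⟩
    lookup (flipAt (flipAt v α) β) δ    ≡⟨ cong (λ w → lookup w δ) eq ⟩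
    lookup (flipAt (flipAt v δ) γ) δ    ≡⟨ lookup-flipAt-≢ (flipAt v δ) (≢-sym γ≢δ) ⟩
    lookup (flipAt v δ) δ               ≡⟨ lookup-flipAt v δ ⟩
    not (lookup v δ)                    ∎) (λ eq′ → not-≢ _ (sym eq′))
    where open ≡-Reasoning
  ...   | yes refl = contradiction (begin
    not (lookup v α)                    ≡⟨ sym (lookup-flipAt v α) ⟩
    lookup (flipAt v α) α               ≡⟨ sym (lookup-flipAt-≢ (flipAt v α) (≢-sym β≢α)) ⟩
    lookup (flipAt (flipAt v α) β) α    ≡⟨ cong (λ w → lookup w α) eq ⟩
    lookup (flipAt (flipAt v γ) γ) α    ≡⟨ cong (λ w → lookup w α) (flipAt-involutive v γ) ⟩
    lookup v α                          ∎) (not-≢ _)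
    where open ≡-Reasoning

FlipEquivariant : ∀ {n} → (Vertex n → Vertex n) → (Fin n → Fin n) → Set
FlipEquivariant f σ = ∀ v i → f (flipAt v i) ≡ flipAt (f v) (σ i)

module _ {n : ℕ} {f : Vertex n → Vertex n} (f-injective : Injective _≡_ _≡_ f)
         (f-adjacent : ∀ u v → Adjacent u v → Adjacent (f u) (f v)) where

  private
    edgeImage : ∀ v i → ∃[ j ] f (flipAt v i) ≡ flipAt (f v) j
    edgeImage v i = Adjacent⇒flipAt (f v) (f (flipAt v i)) (f-adjacent v (flipAt v i) (flipAt-Adjacent v i))

    direction : Vertex n → Fin n → Fin n
    direction v i = proj₁ (edgeImage v i)

    f-flipAt : ∀ v i → f (flipAt v i) ≡ flipAt (f v) (direction v i)
    f-flipAt v i = proj₂ (edgeImage v i)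

    direction-injective : ∀ v → Injective _≡_ _≡_ (direction v)
    direction-injective v {i} {j} eq = flipAt-injectiveʳ v (f-injective
      (trans (f-flipAt v i) (trans (cong (flipAt (f v)) eq) (sym (f-flipAt v j)))))

    direction-flipAt-same : ∀ v i → direction (flipAt v i) i ≡ direction v i
    direction-flipAt-same v i = flipAt-injectiveʳ (f w) (begin
      flipAt (f w) (direction w i)                          ≡⟨ sym (f-flipAt w i) ⟩
      f (flipAt w i)                                        ≡⟨ cong f (flipAt-involutive v i) ⟩
      f v                                                   ≡⟨ sym (flipAt-involutive (f v) (direction v i)) ⟩
      flipAt (flipAt (f v) (direction v i)) (direction v i) ≡⟨ cong (λ u → flipAt u (direction v i)) (sym (f-flipAt v i)) ⟩
      flipAt (f w) (direction v i)                          ∎)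
      where
      open ≡-Reasoning
      w : Vertex n
      w = flipAt v i

    f-square : ∀ v i j → flipAt (flipAt (f v) (direction v i)) (direction (flipAt v i) j)
                       ≡ flipAt (flipAt (f v) (direction v j)) (direction (flipAt v j) i)
    f-square v i j = begin
      flipAt (flipAt (f v) (direction v i)) (direction (flipAt v i) j) ≡⟨ cong (λ u → flipAt u _) (sym (f-flipAt v i)) ⟩
      flipAt (f (flipAt v i)) (direction (flipAt v i) j)               ≡⟨ sym (f-flipAt (flipAt v i) j) ⟩
      f (flipAt (flipAt v i) j)                                        ≡⟨ cong f (flipAt-comm v i j) ⟩
      f (flipAt (flipAt v j) i)                                        ≡⟨ f-flipAt (flipAt v j) i ⟩
      flipAt (f (flipAt v j)) (direction (flipAt v j) i)               ≡⟨ cong (λ u → flipAt u _) (f-flipAt v j) ⟩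
      flipAt (flipAt (f v) (direction v j)) (direction (flipAt v j) i) ∎
      where open ≡-Reasoning

    -- The square v, v+i, v+j, v+i+j goes to a 4-cycle of Q_n, whose opposite edges have equal directions.
    direction-flipAt : ∀ v i j → direction (flipAt v i) j ≡ direction v j
    direction-flipAt v i j with j ≟ᶠ i
    ... | yes refl = direction-flipAt-same v i
    ... | no j≢i with flipAt-square (f v) (f-square v i j) (λ eq → j≢i (sym (direction-injective v eq)))
    ...   | inj₁ same = same
    ...   | inj₂ back = contradiction
      (direction-injective (flipAt v i) (trans back (sym (direction-flipAt-same v i)))) j≢i

    direction-constant : ∀ v i → direction v i ≡ direction zeros i
    direction-constant = flipAt-induction (λ v → ∀ i → direction v i ≡ direction zeros i)
      (λ i → refl) (λ v j IH i → trans (direction-flipAt v j i) (IH i))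

  adjacency-preserving⇒flipEquivariant : ∃[ σ ] Injective _≡_ _≡_ σ × FlipEquivariant f σ
  adjacency-preserving⇒flipEquivariant =
    direction zeros , direction-injective zeros ,
    λ v i → trans (f-flipAt v i) (cong (flipAt (f v)) (direction-constant v i))

parity : ∀ {n} → Vertex n → Bool
parity v = sum (lookup v)

parity-flipAt : ∀ {n} (v : Vertex n) i → parity (flipAt v i) ≡ not (parity v)
parity-flipAt (b ∷ v) zero    = sym (not-distribˡ-xor b (parity v))
parity-flipAt (b ∷ v) (suc i) = trans (cong (b xor_) (parity-flipAt v i)) (sym (not-distribʳ-xor b (parity v)))

parity-zeros : ∀ n → parity (zeros {n}) ≡ false
parity-zeros zero    = refl
parity-zeros (suc n) = parity-zeros n

iterate-flipEquivariant : ∀ {n} {f : Vertex n → Vertex n} {σ} → FlipEquivariant f σ →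
                          ∀ j → FlipEquivariant (λ v → iterate f v j) (λ i → iterate σ i j)
iterate-flipEquivariant f-flipAt zero    v i = refl
iterate-flipEquivariant {f = f} {σ} f-flipAt (suc j) v i =
  trans (cong (λ w → iterate f w j) (f-flipAt v i)) (iterate-flipEquivariant f-flipAt j (f v) (σ i))

module _ {n : ℕ} {f : Vertex n → Vertex n} {σ : Fin n → Fin n} (f-flipAt : FlipEquivariant f σ) where

  lookup-flipEquivariant : Injective _≡_ _≡_ σ →
                           ∀ v c → lookup (f v) (σ c) ≡ lookup v c xor lookup (f zeros) (σ c)
  lookup-flipEquivariant σ-injective = flipAt-induction P base step
    where
    P : Vertex n → Set
    P v = ∀ c → lookup (f v) (σ c) ≡ lookup v c xor lookup (f zeros) (σ c)

    base : P zeros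
    base c = cong (_xor lookup (f zeros) (σ c)) (sym (lookup-replicate c false))

    step : ∀ v i → P v → P (flipAt v i)
    step v i IH c with c ≟ᶠ i
    ... | yes refl = begin
      lookup (f (flipAt v c)) (σ c)              ≡⟨ cong (λ w → lookup w (σ c)) (f-flipAt v c) ⟩
      lookup (flipAt (f v) (σ c)) (σ c)          ≡⟨ lookup-flipAt (f v) (σ c) ⟩
      not (lookup (f v) (σ c))                   ≡⟨ cong not (IH c) ⟩
      not (lookup v c xor lookup (f zeros) (σ c)) ≡⟨ not-distribˡ-xor (lookup v c) _ ⟩
      not (lookup v c) xor lookup (f zeros) (σ c) ≡⟨ cong (_xor lookup (f zeros) (σ c)) (sym (lookup-flipAt v c)) ⟩
      lookup (flipAt v c) c xor lookup (f zeros) (σ c) ∎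
      where open ≡-Reasoning
    ... | no c≢i = begin
      lookup (f (flipAt v i)) (σ c)              ≡⟨ cong (λ w → lookup w (σ c)) (f-flipAt v i) ⟩
      lookup (flipAt (f v) (σ i)) (σ c)          ≡⟨ lookup-flipAt-≢ (f v) (λ eq → c≢i (σ-injective eq)) ⟩
      lookup (f v) (σ c)                         ≡⟨ IH c ⟩
      lookup v c xor lookup (f zeros) (σ c)      ≡⟨ cong (_xor lookup (f zeros) (σ c)) (sym (lookup-flipAt-≢ v c≢i)) ⟩
      lookup (flipAt v i) c xor lookup (f zeros) (σ c) ∎
      where open ≡-Reasoning

  parity-flipEquivariant : ∀ v → parity (f v) ≡ parity v xor parity (f zeros)
  parity-flipEquivariant = flipAt-induction (λ v → parity (f v) ≡ parity v xor parity (f zeros))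
    (cong (_xor parity (f zeros)) (sym (parity-zeros n))) step
    where
    step : ∀ v i → parity (f v) ≡ parity v xor parity (f zeros) →
           parity (f (flipAt v i)) ≡ parity (flipAt v i) xor parity (f zeros)
    step v i IH = begin
      parity (f (flipAt v i))                  ≡⟨ cong parity (f-flipAt v i) ⟩
      parity (flipAt (f v) (σ i))              ≡⟨ parity-flipAt (f v) (σ i) ⟩
      not (parity (f v))                       ≡⟨ cong not IH ⟩
      not (parity v xor parity (f zeros))      ≡⟨ not-distribˡ-xor (parity v) _ ⟩
      not (parity v) xor parity (f zeros)      ≡⟨ cong (_xor parity (f zeros)) (sym (parity-flipAt v i)) ⟩
      parity (flipAt v i) xor parity (f zeros) ∎
      where open ≡-Reasoning

  orbitSum : ℕ → Fin n → Bool
  orbitSum j c = ∑[ i < j ] lookup (f zeros) (σ (iterate σ c (toℕ i)))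

  lookup-iterate : Injective _≡_ _≡_ σ →
                   ∀ j v c → lookup (iterate f v j) (iterate σ c j) ≡ lookup v c xor orbitSum j c
  lookup-iterate σ-injective zero    v c = sym (xor-identityʳ (lookup v c))
  lookup-iterate σ-injective (suc j) v c = begin
    lookup (iterate f (f v) j) (iterate σ (σ c) j)                   ≡⟨ lookup-iterate σ-injective j (f v) (σ c) ⟩
    lookup (f v) (σ c) xor orbitSum j (σ c)
      ≡⟨ cong (_xor orbitSum j (σ c)) (lookup-flipEquivariant σ-injective v c) ⟩
    (lookup v c xor lookup (f zeros) (σ c)) xor orbitSum j (σ c)     ≡⟨ xor-assoc (lookup v c) _ _ ⟩
    lookup v c xor (lookup (f zeros) (σ c) xor orbitSum j (σ c))     ∎
    where open ≡-Reasoning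

  module _ (σ-injective : Injective _≡_ _≡_ σ) {j : ℕ} (σʲ≡id : ∀ c → iterate σ c j ≡ c) where

    iterate-translation : ∀ v c → lookup (iterate f v j) c ≡ lookup v c xor orbitSum j c
    iterate-translation v c =
      subst (λ c′ → lookup (iterate f v j) c′ ≡ lookup v c xor orbitSum j c) (σʲ≡id c)
            (lookup-iterate σ-injective j v c)

    iterate-twice-id : ∀ v → iterate f v (2 * j) ≡ v
    iterate-twice-id v = lookup-injective λ c → begin
      lookup (iterate f v (2 * j)) c               ≡⟨ cong (λ m → lookup (iterate f v (j + m)) c) (+-identityʳ j) ⟩
      lookup (iterate f v (j + j)) c               ≡⟨ cong (λ w → lookup w c) (iterate-+ f v j j) ⟩
      lookup (iterate f (iterate f v j) j) c       ≡⟨ iterate-translation (iterate f v j) c ⟩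
      lookup (iterate f v j) c xor orbitSum j c    ≡⟨ cong (_xor orbitSum j c) (iterate-translation v c) ⟩
      (lookup v c xor orbitSum j c) xor orbitSum j c ≡⟨ xor-assoc (lookup v c) _ _ ⟩
      lookup v c xor (orbitSum j c xor orbitSum j c) ≡⟨ cong (lookup v c xor_) (xor-same (orbitSum j c)) ⟩
      lookup v c xor false                         ≡⟨ xor-identityʳ (lookup v c) ⟩
      lookup v c                                   ∎
      where open ≡-Reasoning

    iterate-id : (∀ c → orbitSum j c ≡ false) → ∀ v → iterate f v j ≡ v
    iterate-id orbitSum≡false v = lookup-injective λ c → begin
      lookup (iterate f v j) c        ≡⟨ iterate-translation v c ⟩
      lookup v c xor orbitSum j c     ≡⟨ cong (lookup v c xor_) (orbitSum≡false c) ⟩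
      lookup v c xor false            ≡⟨ xor-identityʳ (lookup v c) ⟩
      lookup v c                      ∎
      where open ≡-Reasoning

  orbitSum-full : Injective _≡_ _≡_ σ → ∀ {c} → Injective _≡_ _≡_ (λ (i : Fin n) → iterate σ c (toℕ i)) →
                  orbitSum n c ≡ parity (f zeros)
  orbitSum-full σ-injective orbit-injective =
    trans (sum-reindex (λ c → lookup (f zeros) (σ c)) orbit-injective) (sum-reindex (lookup (f zeros)) σ-injective)

module _ (n : ℕ) where

  private instance
    N≢0 : NonZero (N n)
    N≢0 = N-nonZero n

  toℕ-shift : ∀ a i → toℕ (shift n a i) ≡ (toℕ i + a) % N n
  toℕ-shift a i = toℕ-fromℕ< _

  shift-+ : ∀ a b i → shift n a (shift n b i) ≡ shift n (b + a) i
  shift-+ a b i = toℕ-injective (begin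
    toℕ (shift n a (shift n b i))  ≡⟨ toℕ-shift a _ ⟩
    (toℕ (shift n b i) + a) % N n  ≡⟨ cong (λ m → (m + a) % N n) (toℕ-shift b i) ⟩
    ((toℕ i + b) % N n + a) % N n  ≡⟨ [m%n+o]%n≡[m+o]%n (toℕ i + b) a (N n) ⟩
    (toℕ i + b + a) % N n          ≡⟨ cong (_% N n) (+-assoc (toℕ i) b a) ⟩
    (toℕ i + (b + a)) % N n        ≡⟨ sym (toℕ-shift (b + a) i) ⟩
    toℕ (shift n (b + a) i)        ∎)
    where open ≡-Reasoning

  shift-0 : ∀ i → shift n 0 i ≡ i
  shift-0 i = toℕ-injective (trans (toℕ-shift 0 i)
    (trans (cong (_% N n) (+-identityʳ (toℕ i))) (m<n⇒m%n≡m (toℕ<n i))))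

  shift-N : ∀ i → shift n (N n) i ≡ i
  shift-N i = toℕ-injective (trans (toℕ-shift (N n) i)
    (trans ([m+n]%n≡m%n (toℕ i) (N n)) (m<n⇒m%n≡m (toℕ<n i))))

xor-≡ˡ : ∀ a b → a xor b ≡ a → b ≡ false
xor-≡ˡ true  true  ()
xor-≡ˡ true  false _  = refl
xor-≡ˡ false b     eq = eq

module SymmetricHamiltonCycle
  {n k : ℕ} {{k≢0 : NonZero k}} (k∣N : k ∣ N n)
  {x : Fin (N n) → Vertex n} (x-injective : Injective _≡_ _≡_ x) (x-surjective : Surjective _≡_ _≡_ x)
  (x-adjacent : ∀ i → Adjacent (x i) (x (shift n 1 i)))
  {f : Vertex n → Vertex n} (f-injective : Injective _≡_ _≡_ f)
  (f-adjacent : ∀ u v → Adjacent u v → Adjacent (f u) (f v))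
  (f-shifts : ∀ i → f (x i) ≡ x (shift n (N n / k) i)) where

  private instance
    N≢0 : NonZero (N n)
    N≢0 = N-nonZero n

  s : ℕ
  s = N n / k

  s*k≡N : s * k ≡ N n
  s*k≡N = m/n*n≡m k∣N

  0<s : 0 < s
  0<s = n≢0⇒n>0 λ s≡0 → ≢-nonZero⁻¹ (N n) (trans (sym s*k≡N) (cong (_* k) s≡0))

  i₀ : Fin (N n)
  i₀ = fromℕ< (m^n>0 2 n)

  iterate-f-x : ∀ j i → iterate f (x i) j ≡ x (shift n (j * s) i)
  iterate-f-x zero    i = cong x (sym (shift-0 n i))
  iterate-f-x (suc j) i = begin
    iterate f (f (x i)) j           ≡⟨ cong (λ v → iterate f v j) (f-shifts i) ⟩
    iterate f (x (shift n s i)) j   ≡⟨ iterate-f-x j (shift n s i) ⟩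
    x (shift n (j * s) (shift n s i)) ≡⟨ cong x (shift-+ n (j * s) s i) ⟩
    x (shift n (s + j * s) i)       ∎
    where open ≡-Reasoning

  f-order : ∀ v → iterate f v k ≡ v
  f-order v with i , xᵢ≡v ← x-surjective v = begin
    iterate f v k                 ≡⟨ cong (λ w → iterate f w k) (sym (xᵢ≡v refl)) ⟩
    iterate f (x i) k             ≡⟨ iterate-f-x k i ⟩
    x (shift n (k * s) i)         ≡⟨ cong (λ m → x (shift n m i)) (trans (*-comm k s) s*k≡N) ⟩
    x (shift n (N n) i)           ≡⟨ cong x (shift-N n i) ⟩
    x i                           ≡⟨ xᵢ≡v refl ⟩
    v                             ∎
    where open ≡-Reasoning

  f-moves : ∀ {j} → 0 < j → j < k → iterate f (x i₀) j ≢ x i₀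
  f-moves {j} 0<j j<k fʲx≡x = m<n⇒n≢0 (*-mono-< 0<j 0<s) (begin
    j * s                          ≡⟨ sym (m<n⇒m%n≡m js<N) ⟩
    (j * s) % N n                  ≡⟨ cong (λ m → (m + j * s) % N n) (sym (toℕ-fromℕ< (m^n>0 2 n))) ⟩
    (toℕ i₀ + j * s) % N n         ≡⟨ sym (toℕ-shift n (j * s) i₀) ⟩
    toℕ (shift n (j * s) i₀)       ≡⟨ cong toℕ (x-injective (trans (sym (iterate-f-x j i₀)) fʲx≡x)) ⟩
    toℕ i₀                         ≡⟨ toℕ-fromℕ< _ ⟩
    0                              ∎)
    where
    open ≡-Reasoning
    js<N : j * s < N n
    js<N = subst (j * s <_) (trans (*-comm k s) s*k≡N) (*-monoˡ-< s {{>-nonZero 0<s}} j<k)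

  private
    equivariance : ∃[ σ ] Injective _≡_ _≡_ σ × FlipEquivariant f σ
    equivariance = adjacency-preserving⇒flipEquivariant f-injective f-adjacent

  σ : Fin n → Fin n
  σ = proj₁ equivariance

  σ-injective : Injective _≡_ _≡_ σ
  σ-injective = proj₁ (proj₂ equivariance)

  f-flipAt : FlipEquivariant f σ
  f-flipAt = proj₂ (proj₂ equivariance)

  σ-order : ∀ c → iterate σ c k ≡ c
  σ-order c = sym (flipAt-injectiveʳ zeros (begin
    flipAt zeros c                              ≡⟨ sym (f-order _) ⟩
    iterate f (flipAt zeros c) k                ≡⟨ iterate-flipEquivariant f-flipAt k zeros c ⟩
    flipAt (iterate f zeros k) (iterate σ c k)  ≡⟨ cong (λ w → flipAt w (iterate σ c k)) (f-order zeros) ⟩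
    flipAt zeros (iterate σ c k)                ∎))
    where open ≡-Reasoning

  parity-successor : ∀ i → parity (x (shift n 1 i)) ≡ not (parity (x i))
  parity-successor i with d , xᵢ₊₁≡ ← Adjacent⇒flipAt (x i) (x (shift n 1 i)) (x-adjacent i) =
    trans (cong parity xᵢ₊₁≡) (parity-flipAt (x i) d)

  parity-even-shift : ∀ m i → parity (x (shift n (2 * m) i)) ≡ parity (x i)
  parity-even-shift zero    i = cong (λ j → parity (x j)) (shift-0 n i)
  parity-even-shift (suc m) i = begin
    parity (x (shift n (2 * suc m) i))                      ≡⟨ cong (λ a → parity (x (shift n a i))) 2[1+m]≡2m+2 ⟩
    parity (x (shift n (2 * m + 2) i))                      ≡⟨ cong (λ j → parity (x j)) (sym two-steps) ⟩
    parity (x (shift n 1 (shift n 1 (shift n (2 * m) i)))) ≡⟨ parity-successor _ ⟩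
    not (parity (x (shift n 1 (shift n (2 * m) i))))        ≡⟨ cong not (parity-successor _) ⟩
    not (not (parity (x (shift n (2 * m) i))))              ≡⟨ not-involutive _ ⟩
    parity (x (shift n (2 * m) i))                          ≡⟨ parity-even-shift m i ⟩
    parity (x i)                                            ∎
    where
    open ≡-Reasoning
    2[1+m]≡2m+2 : 2 * suc m ≡ 2 * m + 2
    2[1+m]≡2m+2 = trans (*-suc 2 m) (+-comm 2 (2 * m))

    two-steps : shift n 1 (shift n 1 (shift n (2 * m) i)) ≡ shift n (2 * m + 2) i
    two-steps = trans (shift-+ n 1 1 _) (shift-+ n 2 (2 * m) i)

  even-step⇒parity-preserving : ∀ {m} → s ≡ 2 * m → parity (f zeros) ≡ false
  even-step⇒parity-preserving {m} s≡2m = xor-≡ˡ (parity (x i₀)) _ (begin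
    parity (x i₀) xor parity (f zeros)  ≡⟨ sym (parity-flipEquivariant f-flipAt (x i₀)) ⟩
    parity (f (x i₀))                   ≡⟨ cong parity (f-shifts i₀) ⟩
    parity (x (shift n s i₀))           ≡⟨ cong (λ a → parity (x (shift n a i₀))) s≡2m ⟩
    parity (x (shift n (2 * m) i₀))     ≡⟨ parity-even-shift m i₀ ⟩
    parity (x i₀)                       ∎)
    where open ≡-Reasoning

  k<N⇒even-step : k < N n → ∃[ m ] s ≡ 2 * m
  k<N⇒even-step k<N with ∣2^⇒≡2^ n (divides k (trans (sym s*k≡N) (*-comm s k)))
  ... | zero  , s≡1 =
    contradiction (trans (sym (*-identityˡ k)) (trans (cong (_* k) (sym s≡1)) s*k≡N)) (<⇒≢ k<N)
  ... | suc j , s≡2^1+j = 2 ^ j , s≡2^1+j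

  private
    module LargeSymmetry (3≤n : 3 ≤ n) (i : ℕ) (k≡4q : k ≡ 2 ^ (2 + i)) (2n≤k : 2 * n ≤ k) where

      q : ℕ
      q = 2 ^ i

      0<q : 0 < q
      0<q = m^n>0 2 i

      σ^q-not-id : ¬ (∀ c → iterate σ c q ≡ c)
      σ^q-not-id σ^q≡id = f-moves (*-monoʳ-< 2 0<q) (subst (2 * q <_) (sym k≡4q) (m<2*m (*-monoʳ-< 2 0<q)))
        (iterate-twice-id f-flipAt σ-injective {q} σ^q≡id (x i₀))

      moved⇒full-cycle : ∀ {d} → iterate σ d q ≢ d → k ≡ 2 * n × LeastPeriod σ d n
      moved⇒full-cycle {d} moved with leastPeriod-exists _≟ᶠ_ (>-nonZero⁻¹ k) (σ-order d)
      ... | p , period with ∣2^⇒≡2^ (2 + i) (subst (p ∣_) k≡4q (leastPeriod-∣ period (σ-order d)))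
      ...   | u , refl with 2^u∣2^i⊎2^[1+i]≤2^u u i
      ...     | inj₁ (divides c q≡c*p) = contradiction (subst (λ j → iterate σ d j ≡ d) (sym q≡c*p)
                                           (iterate-*-fixed σ (LeastPeriod.returns period) c)) moved
      ...     | inj₂ 2q≤p = trans k≡4q (cong (2 *_) 2q≡n) , subst (LeastPeriod σ d) p≡n period
        where
        n≤2q : n ≤ 2 * q
        n≤2q = *-cancelˡ-≤ 2 (subst (2 * n ≤_) k≡4q 2n≤k)

        p≤n : 2 ^ u ≤ n
        p≤n = leastPeriod-≤ σ-injective period

        p≡n : 2 ^ u ≡ n
        p≡n = ≤-antisym p≤n (≤-trans n≤2q 2q≤p)

        2q≡n : 2 * q ≡ n
        2q≡n = ≤-antisym (≤-trans 2q≤p p≤n) n≤2q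

      full-cycle⇒⊥ : ∀ {d} → k ≡ 2 * n → LeastPeriod σ d n → ⊥
      full-cycle⇒⊥ k≡2n period = f-moves 0<n (subst (n <_) (sym k≡2n) (m<2*m 0<n))
        (iterate-id f-flipAt σ-injective {n} σⁿ≡id orbitSum≡false (x i₀))
        where
        0<n : 0 < n
        0<n = ≤-trans (s≤s z≤n) 3≤n

        σⁿ≡id : ∀ c → iterate σ c n ≡ c
        σⁿ≡id c = proj₁ (full-cycle σ-injective period c)

        f-preserves-parity : parity (f zeros) ≡ false
        f-preserves-parity with m , s≡2m ← k<N⇒even-step (subst (_< N n) (sym k≡2n) (2*n<2^n 3≤n)) =
          even-step⇒parity-preserving {m} s≡2m

        orbitSum≡false : ∀ c → orbitSum f-flipAt n c ≡ false
        orbitSum≡false c =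
          trans (orbitSum-full f-flipAt σ-injective {c} (proj₂ (full-cycle σ-injective period c))) f-preserves-parity

      large⇒⊥ : ⊥
      large⇒⊥ with all? (λ c → iterate σ c q ≟ᶠ c)
      ... | yes σ^q≡id = σ^q-not-id σ^q≡id
      ... | no σ^q≢id with d , moved ← ¬∀⟶∃¬ n _ (λ c → iterate σ c q ≟ᶠ c) σ^q≢id =
        uncurry full-cycle⇒⊥ (moved⇒full-cycle moved)

  k<2*n : 3 ≤ n → k < 2 * n
  k<2*n 3≤n = ≰⇒> large⇒⊥
    where
    large⇒⊥ : 2 * n ≤ k → ⊥
    large⇒⊥ 2n≤k with ∣2^⇒≡2^ n k∣N | ≤-trans (*-monoʳ-≤ 2 3≤n) 2n≤k
    ... | zero           , k≡1  | 6≤k = contradiction (subst (6 ≤_) k≡1 6≤k) λ { (s≤s ()) }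
    ... | suc zero       , k≡2  | 6≤k = contradiction (subst (6 ≤_) k≡2 6≤k) λ { (s≤s (s≤s ())) }
    ... | suc (suc i)    , k≡4q | _   = LargeSymmetry.large⇒⊥ 3≤n i k≡4q 2n≤k

lemma3p2 : (n k : ℕ) → 3 ≤ n →
    (Σ (Fin (N n) → Vertex n) λ x → IsHamiltonCycle n x × IsKSymmetric n k x) →
    Σ ℕ λ i → (k ≡ 2 ^ i) × (k < 2 * n)
lemma3p2 n k 3≤n (x , (x-injective , x-surjective , x-adjacent) ,
                     (k≢0 , k∣N , f , (f-injective , _ , f-adjacent) , f-shifts)) =
  let i , k≡2^i = ∣2^⇒≡2^ n k∣N in
  i , k≡2^i , SymmetricHamiltonCycle.k<2*n {{k≢0}} k∣N x-injective x-surjective x-adjacent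
                f-injective (λ u v → proj₁ (f-adjacent u v)) f-shifts 3≤n
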